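{- A set $L\subseteq\mathsf V\Sigma$ has bounded cliquewidth if and only if it is contained in the subset of $\mathsf V\Sigma$ generated by some finite set of polynomial operations of the $\mathsf V$-algebra $\mathsf V\Sigma$.
   Context: Ranked sets here have arities in $\{1,2,\dots\}$. A corner $v[i]$ is an element $v$ with $1\le i\le$ arity of $v$. A $\mathsf V$-hypergraph over $\Sigma$: nonempty ranked set of hypervertices, arity-preserving labelling by $\Sigma$, binary edge relation on corners. An $n$-ary one with ports has a port function from corners to $\{1..n\}$ (not necessarily surjective). $\mathsf V\Sigma$: finite ones up to isomorphism. Flattening of $G\in\mathsf{VV}\Sigma$: hypervertices $(v,w)$ ($w$ in the label of $v$, label from $w$); $(v,w)[i]$ has port equal to the port in $G$ of $v[j]$, $j$ the port of $w[i]$ in the label of $v$; edges $(v,w)[i]\to(v',w')[i']$ iff ($v=v'$ and $w[i]\to w'[i']$ in the label of $v$) or $v[j]\to v'[j']$ in $G$ ($j,j'$ the ports of $w[i],w'[i']$). Polynomial operations of $\mathsf V\Sigma$: for a ranked set $X$ of variables (possibly empty) and $t\in\mathsf V(\mathsf V\Sigma+X)$, the map sending arity-preserving $\eta:X\to\mathsf V\Sigma$ to the flattening of $t$ with variables substituted by $\eta$. The subset generated by a set $P$ of operations is the least subset closed under applying operations from $P$. VR-operations: for each $n$, disjoint union of two $n$-ary elements; a constant for every unit (single hypervertex $v$ labelled $a$, ports $v[i]\mapsto i$, no edges); for each $f:\{1..n\}\to\{1..m\}$, relabelling ports along $f$; for each $E\subseteq\{1..n\}^2$, adding directed edges from every $i$-port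 to every $j$-port for $(i,j)\in E$. The cliquewidth of $G\in\mathsf V\Sigma$ is the smallest $n\ge1$ such that $G$ can be generated by VR-operations using only arities $\le n$. -}

module Defs where

open import Data.Nat using (ℕ; zero; suc; _+_; _≤_; z≤n; s≤s)
open import Data.Nat.Properties using (≤-trans; m≤m+n)
open import Data.Fin using (Fin; zero; suc; splitAt; cast; _≟_)
open import Data.Bool using (Bool; true; false; _∨_)
open import Data.Sum using (_⊎_; inj₁; inj₂)
open import Data.Product using (Σ; Σ-syntax; ∃; _×_; _,_; proj₁; proj₂)
open import Data.List using (List)
open import Data.List.Membership.Propositional using (_∈_)
open import Function using (_∘_)
open import Function.Bundles using (_↔_; Inverse)
open import Relation.Nullary using (yes; no)
open import Relation.Binary.PropositionalEquality using (_≡_; refl; sym; cong)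

record Ranked : Set₁ where
  field
    Carrier   : Set
    arity     : Carrier → ℕ
    arity-pos : ∀ a → 1 ≤ arity a
open Ranked public

Finite : Ranked → Set
Finite A = Σ[ k ∈ ℕ ] (Carrier A ↔ Fin k)

_⊕_ : Ranked → Ranked → Ranked
A ⊕ B = record
  { Carrier   = Carrier A ⊎ Carrier B
  ; arity     = λ { (inj₁ a) → arity A a ; (inj₂ b) → arity B b }
  ; arity-pos = λ { (inj₁ a) → arity-pos A a ; (inj₂ b) → arity-pos B b }
  }

Corner : (A : Ranked) (s : ℕ) → (Fin s → Carrier A) → Set
Corner A s lab = Σ[ v ∈ Fin s ] Fin (arity A (lab v))

record HG (A : Ranked) (n : ℕ) : Set where
  field
    size     : ℕ
    nonempty : 1 ≤ size
    label    : Fin size → Carrier A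
    edge     : Corner A size label → Corner A size label → Bool
    port     : Corner A size label → Fin n
open HG public

isoCorner : ∀ {A n} (G H : HG A n) (φ : Fin (size G) ↔ Fin (size H)) →
            (∀ v → label H (Inverse.to φ v) ≡ label G v) →
            Corner A (size G) (label G) → Corner A (size H) (label H)
isoCorner {A} G H φ lab (v , i) = Inverse.to φ v , cast (cong (arity A) (sym (lab v))) i

record _≅_ {A : Ranked} {n : ℕ} (G H : HG A n) : Set where
  field
    vmap      : Fin (size G) ↔ Fin (size H)
    label-pres : ∀ v → label H (Inverse.to vmap v) ≡ label G v
    port-pres : ∀ c → port H (isoCorner G H vmap label-pres c) ≡ port G c
    edge-pres : ∀ c d → edge H (isoCorner G H vmap label-pres c)
                                (isoCorner G H vmap label-pres d) ≡ edge G c d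

VElem : Ranked → Set
VElem A = Σ[ n ∈ ℕ ] (1 ≤ n × HG A n)

V : Ranked → Ranked
V A = record { Carrier = VElem A ; arity = proj₁ ; arity-pos = λ e → proj₁ (proj₂ e) }


sumF : (s : ℕ) → (Fin s → ℕ) → ℕ
sumF zero    f = 0
sumF (suc s) f = f zero + sumF s (f ∘ suc)

unpair : (s : ℕ) (f : Fin s → ℕ) → Fin (sumF s f) → Σ[ v ∈ Fin s ] Fin (f v)
unpair zero    f ()
unpair (suc s) f k with splitAt (f zero) k
... | inj₁ w  = zero , w
... | inj₂ k' = suc (proj₁ (unpair s (f ∘ suc) k')) , proj₂ (unpair s (f ∘ suc) k')

sumF-pos : (s : ℕ) (f : Fin s → ℕ) → 1 ≤ s → (∀ v → 1 ≤ f v) → 1 ≤ sumF s f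
sumF-pos (suc s) f _ p = ≤-trans (p zero) (m≤m+n (f zero) (sumF s (f ∘ suc)))

module Flatten {A : Ranked} {n : ℕ} (G : HG (V A) n) where
  m : Fin (size G) → ℕ
  m v = proj₁ (label G v)

  H : (v : Fin (size G)) → HG A (m v)
  H v = proj₂ (proj₂ (label G v))

  N : ℕ
  N = sumF (size G) (λ v → size (H v))

  dec : Fin N → Σ[ v ∈ Fin (size G) ] Fin (size (H v))
  dec = unpair (size G) (λ v → size (H v))

  lab : Fin N → Carrier A
  lab k = label (H (proj₁ (dec k))) (proj₂ (dec k))

  innerEdge : (v v' : Fin (size G)) →
              Corner A (size (H v)) (label (H v)) →
              Corner A (size (H v')) (label (H v')) → Bool
  innerEdge v v' c c' with v ≟ v'
  ... | yes refl = edge (H v) c c'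
  ... | no _     = false

  toInner : (c : Corner A N lab) → Corner A (size (H (proj₁ (dec (proj₁ c))))) (label (H (proj₁ (dec (proj₁ c)))))
  toInner (k , i) = proj₂ (dec k) , i

  flatPort : Corner A N lab → Fin n
  flatPort c = port G (proj₁ (dec (proj₁ c)) , port (H (proj₁ (dec (proj₁ c)))) (toInner c))

  flatEdge : Corner A N lab → Corner A N lab → Bool
  flatEdge c c' =
    innerEdge (proj₁ (dec (proj₁ c))) (proj₁ (dec (proj₁ c'))) (toInner c) (toInner c')
    ∨ edge G (proj₁ (dec (proj₁ c))  , port (H (proj₁ (dec (proj₁ c))))  (toInner c))
             (proj₁ (dec (proj₁ c')) , port (H (proj₁ (dec (proj₁ c')))) (toInner c'))

  flat : HG A n
  flat = record
    { size     = N
    ; nonempty = sumF-pos (size G) (λ v → size (H v)) (nonempty G) (λ v → nonempty (H v))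
    ; label    = lab
    ; edge     = flatEdge
    ; port     = flatPort
    }

flatten : ∀ {A n} → HG (V A) n → HG A n
flatten G = Flatten.flat G

module Subst {A X : Ranked} (η : (x : Carrier X) → HG A (arity X x)) where
  relab : Carrier (V A ⊕ X) → Carrier (V A)
  relab (inj₁ e) = e
  relab (inj₂ x) = arity X x , arity-pos X x , η x

  conv : (l : Carrier (V A ⊕ X)) → Fin (arity (V A) (relab l)) → Fin (arity (V A ⊕ X) l)
  conv (inj₁ e) i = i
  conv (inj₂ x) i = i

  substitute : ∀ {n} → HG (V A ⊕ X) n → HG (V A) n
  substitute t = record
    { size     = size t
    ; nonempty = nonempty t
    ; label    = λ v → relab (label t v)
    ; edge     = λ c d → edge t (proj₁ c , conv (label t (proj₁ c)) (proj₂ c))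
                                (proj₁ d , conv (label t (proj₁ d)) (proj₂ d))
    ; port     = λ c → port t (proj₁ c , conv (label t (proj₁ c)) (proj₂ c))
    }

record PolyOp (A : Ranked) : Set₁ where
  field
    Vars  : Ranked
    arOut : ℕ
    arOut-pos : 1 ≤ arOut
    term  : HG (V A ⊕ Vars) arOut
open PolyOp public

Valuation : (A : Ranked) → PolyOp A → Set
Valuation A P = (x : Carrier (Vars P)) → HG A (arity (Vars P) x)

applyOp : ∀ {A} (P : PolyOp A) → Valuation A P → HG A (arOut P)
applyOp P η = flatten (Subst.substitute η (term P))

-- the subset of V A generated by a set of polynomial operations
-- (as a set of isomorphism classes, hence closed under ≅)
data PGen {A : Ranked} (Ps : List (PolyOp A)) : (n : ℕ) → HG A n → Set₁ where
  app : (P : PolyOp A) → P ∈ Ps → (η : Valuation A P) →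
        (∀ x → PGen Ps (arity (Vars P) x) (η x)) →
        PGen Ps (arOut P) (applyOp P η)
  iso : ∀ {n} {G H : HG A n} → G ≅ H → PGen Ps n H → PGen Ps n G

unitHG : ∀ {A} (a : Carrier A) → HG A (arity A a)
unitHG a = record
  { size = 1 ; nonempty = s≤s z≤n ; label = λ _ → a
  ; edge = λ _ _ → false ; port = λ c → proj₂ c }

module Union {A : Ranked} {n : ℕ} (G H : HG A n) where
  S : Set
  S = Fin (size G) ⊎ Fin (size H)

  labS : S → Carrier A
  labS (inj₁ v) = label G v
  labS (inj₂ v) = label H v

  edgeS : (s s' : S) → Fin (arity A (labS s)) → Fin (arity A (labS s')) → Bool
  edgeS (inj₁ v) (inj₁ v') i i' = edge G (v , i) (v' , i')
  edgeS (inj₂ v) (inj₂ v') i i' = edge H (v , i) (v' , i')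
  edgeS (inj₁ _) (inj₂ _)  _ _  = false
  edgeS (inj₂ _) (inj₁ _)  _ _  = false

  portS : (s : S) → Fin (arity A (labS s)) → Fin n
  portS (inj₁ v) i = port G (v , i)
  portS (inj₂ v) i = port H (v , i)

  union : HG A n
  union = record
    { size = size G + size H
    ; nonempty = ≤-trans (nonempty G) (m≤m+n (size G) (size H))
    ; label = λ k → labS (splitAt (size G) k)
    ; edge = λ c d → edgeS (splitAt (size G) (proj₁ c)) (splitAt (size G) (proj₁ d)) (proj₂ c) (proj₂ d)
    ; port = λ c → portS (splitAt (size G) (proj₁ c)) (proj₂ c)
    }

_⊔_ : ∀ {A n} → HG A n → HG A n → HG A n
G ⊔ H = Union.union G H

relabelPorts : ∀ {A n m} → (Fin n → Fin m) → HG A n → HG A m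
relabelPorts f G = record
  { size = size G ; nonempty = nonempty G ; label = label G
  ; edge = edge G ; port = λ c → f (port G c) }

addEdges : ∀ {A n} → (Fin n → Fin n → Bool) → HG A n → HG A n
addEdges E G = record
  { size = size G ; nonempty = nonempty G ; label = label G
  ; edge = λ c d → edge G c d ∨ E (port G c) (port G d) ; port = port G }

data VRGen {A : Ranked} (N : ℕ) : (n : ℕ) → HG A n → Set where
  unit    : (a : Carrier A) → arity A a ≤ N → VRGen N (arity A a) (unitHG a)
  union   : ∀ {n} {G H} → n ≤ N → VRGen N n G → VRGen N n H → VRGen N n (G ⊔ H)
  relabel : ∀ {n m G} → n ≤ N → m ≤ N → (f : Fin n → Fin m) →
            VRGen N n G → VRGen N m (relabelPorts f G)
  edges   : ∀ {n G} → n ≤ N → (E : Fin n → Fin n → Bool) →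
            VRGen N n G → VRGen N n (addEdges E G)
  iso     : ∀ {n} {G H : HG A n} → G ≅ H → VRGen N n H → VRGen N n G

-- cliquewidth(G) ≤ N : the least n ≥ 1 with VRGen n G is ≤ N
CliquewidthAtMost : ∀ {A n} → ℕ → HG A n → Set
CliquewidthAtMost {A} {k} N G = Σ[ n ∈ ℕ ] (1 ≤ n × n ≤ N × VRGen {A} n k G)

BoundedCliquewidth : (A : Ranked) → (VElem A → Set) → Set
BoundedCliquewidth A L = Σ[ N ∈ ℕ ] (∀ e → L e → CliquewidthAtMost N (proj₂ (proj₂ e)))

PolyGenerated : (A : Ranked) → (VElem A → Set) → Set₁
PolyGenerated A L = Σ[ Ps ∈ List (PolyOp A) ] (∀ e → L e → PGen Ps (proj₁ e) (proj₂ (proj₂ e)))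

-- Flattening is itself a VR-construction: the flattening of a term T is the disjoint union of
-- its blocks, each with its ports sent injectively to the corners of T, followed by adding
-- the edges of T between those corners and relabelling them along the ports of T.  Hence a
-- polynomial operation is a VR-derived operation of width bounded by its output arity, the
-- total arity of its term and the widths of its constants (each constant G being the
-- flattening of its unit term, of width n ⊔ Σ arities).  Finitely many operations thus
-- generate a set of bounded cliquewidth.  Conversely each VR-operation of arity ≤ N is a
-- polynomial operation (a constant unit, two variables side by side, or one variable with
-- added edges and relabelled ports), and there are finitely many of them up to pointwise
-- equality of port maps and edge relations.
module Submission where

open import Defs
open import Data.Nat using (ℕ; zero; suc; _+_; _≤_; z≤n; s≤s) renaming (_⊔_ to _⊔ℕ_)
open import Data.Nat.Properties
  using (≤-refl; ≤-trans; n≤1+n; m≤m+n; m≤n+m; +-mono-≤; m≤m⊔n; m≤n⊔m)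
open import Data.Fin using (Fin; zero; suc; splitAt; cast; fromℕ<; _↑ˡ_; _↑ʳ_; _≟_)
open import Data.Fin.Properties
  using (¬Fin0; +↔⊎; cast-is-id; cast-trans; splitAt-↑ˡ; splitAt-↑ʳ; join-splitAt)
open import Data.Bool using (Bool; true; false; _∨_)
open import Data.Bool.Properties using (∨-identityʳ)
open import Data.Empty using (⊥; ⊥-elim)
open import Data.Unit using (⊤; tt)
open import Data.Sum using (_⊎_; inj₁; inj₂)
open import Data.Product using (Σ-syntax; ∃-syntax; _×_; _,_; proj₁; proj₂)
open import Data.List as List using (List; []; _∷_; _++_)
open import Data.List.Extrema.Nat using (max; xs≤max)
open import Data.List.Membership.Propositional using (_∈_)
open import Data.List.Membership.Propositional.Properties
  using (∈-map⁺; ∈-allFin; ∈-cartesianProductWith⁺; ∈-concat⁺′; ∈-upTo⁺; ∈-++⁺ˡ; ∈-++⁺ʳ)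
open import Data.List.Relation.Unary.Any using (here; there)
import Data.List.Relation.Unary.All as All
import Data.Vec.Functional as Vec
open import Function using (_∘_; id)
open import Function.Bundles using (_↔_; Inverse; mk↔ₛ′; _⇔_; mk⇔)
open import Function.Properties.Inverse using (↔-refl; ↔-sym; ↔-trans)
open import Relation.Binary.PropositionalEquality
open import Relation.Nullary using (yes; no)

pair : (s : ℕ) (f : Fin s → ℕ) → Σ[ v ∈ Fin s ] Fin (f v) → Fin (sumF s f)
pair (suc s) f (zero , w)  = w ↑ˡ sumF s (f ∘ suc)
pair (suc s) f (suc v , w) = f zero ↑ʳ pair s (f ∘ suc) (v , w)

unpair-pair : ∀ s f x → unpair s f (pair s f x) ≡ x
unpair-pair (suc s) f (zero , w)
  rewrite splitAt-↑ˡ (f zero) w (sumF s (f ∘ suc)) = refl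
unpair-pair (suc s) f (suc v , w)
  rewrite splitAt-↑ʳ (f zero) (sumF s (f ∘ suc)) (pair s (f ∘ suc) (v , w))
        | unpair-pair s (f ∘ suc) (v , w) = refl

pair-unpair : ∀ s f k → pair s f (unpair s f k) ≡ k
pair-unpair (suc s) f k with splitAt (f zero) k | join-splitAt (f zero) (sumF s (f ∘ suc)) k
... | inj₁ w  | eq = eq
... | inj₂ k′ | eq = trans (cong (f zero ↑ʳ_) (pair-unpair s (f ∘ suc) k′)) eq

Σ↔sumF : (s : ℕ) (f : Fin s → ℕ) → (Σ[ v ∈ Fin s ] Fin (f v)) ↔ Fin (sumF s f)
Σ↔sumF s f = mk↔ₛ′ (pair s f) (unpair s f) (pair-unpair s f) (unpair-pair s f)

≤-sumF : ∀ s (f : Fin s → ℕ) u → f u ≤ sumF s f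
≤-sumF (suc s) f zero    = m≤m+n (f zero) _
≤-sumF (suc s) f (suc u) = ≤-trans (≤-sumF s (f ∘ suc) u) (m≤n+m _ (f zero))

sumF-mono-≤ : ∀ s (f g : Fin s → ℕ) → (∀ u → f u ≤ g u) → sumF s f ≤ sumF s g
sumF-mono-≤ zero    f g f≤g = z≤n
sumF-mono-≤ (suc s) f g f≤g =
  +-mono-≤ (f≤g zero) (sumF-mono-≤ s (f ∘ suc) (g ∘ suc) (f≤g ∘ suc))

dcong-cast : {D X : Set} {Q : D → ℕ} (F : (d : D) → Fin (Q d) → X) {d d′ : D} → d ≡ d′ →
             (i : Fin (Q d′)) .(e : Q d′ ≡ Q d) → F d (cast e i) ≡ F d′ i
dcong-cast F refl i e = cong (F _) (cast-is-id e i)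

module _ {A : Ranked} {n : ℕ} where

  -- flatten T, G ⊔ H, relabelPorts and addEdges are all definitionally of the form
  -- realise P s ne d, so realise-≅ applies to them directly.
  record Presentation : Set₁ where
    field
      Index   : Set
      labelAt : Index → Carrier A
      portAt  : (x : Index) → Fin (arity A (labelAt x)) → Fin n
      edgeAt  : (x : Index) → Fin (arity A (labelAt x)) →
                (y : Index) → Fin (arity A (labelAt y)) → Bool
  open Presentation public

  realise : (P : Presentation) (s : ℕ) → 1 ≤ s → (Fin s → Index P) → HG A n
  realise P s ne d = record
    { size     = s
    ; nonempty = ne
    ; label    = labelAt P ∘ d
    ; edge     = λ c c′ → edgeAt P (d (proj₁ c)) (proj₂ c) (d (proj₁ c′)) (proj₂ c′)
    ; port     = λ c → portAt P (d (proj₁ c)) (proj₂ c)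
    }

  record PresentationMap (Q P : Presentation) : Set where
    field
      map       : Index Q → Index P
      label-map : ∀ y → labelAt P (map y) ≡ labelAt Q y
      port-map  : ∀ y j .(e : arity A (labelAt Q y) ≡ arity A (labelAt P (map y))) →
                  portAt P (map y) (cast e j) ≡ portAt Q y j
      edge-map  : ∀ y j z k .(e : arity A (labelAt Q y) ≡ arity A (labelAt P (map y)))
                  .(e′ : arity A (labelAt Q z) ≡ arity A (labelAt P (map z))) →
                  edgeAt P (map y) (cast e j) (map z) (cast e′ k) ≡ edgeAt Q y j z k

  realise-≅ : ∀ {P Q s t ne ne′} (f : PresentationMap Q P)
              (d : Fin s → Index P) (d′ : Fin t → Index Q) (φ : Fin s ↔ Fin t) →
              (∀ v → PresentationMap.map f (d′ (Inverse.to φ v)) ≡ d v) →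
              realise P s ne d ≅ realise Q t ne′ d′
  realise-≅ {P} {Q} f d d′ φ commutes = record
    { vmap       = φ
    ; label-pres = label-pres
    ; port-pres  = λ (v , i) → ports-agree v i
    ; edge-pres  = λ (v , i) (w , j) → edges-agree v i w j
    }
    where
    open PresentationMap f
    to = Inverse.to φ
    ar = arity A

    label-pres : ∀ v → labelAt Q (d′ (to v)) ≡ labelAt P (d v)
    label-pres v = trans (sym (label-map _)) (cong (labelAt P) (commutes v))

    toQ : ∀ v → ar (labelAt P (d v)) ≡ ar (labelAt Q (d′ (to v)))
    toQ v = cong ar (sym (label-pres v))
    backP : ∀ v → ar (labelAt Q (d′ (to v))) ≡ ar (labelAt P (map (d′ (to v))))
    backP v = cong ar (sym (label-map _))
    viaQ : ∀ v → ar (labelAt P (d v)) ≡ ar (labelAt P (map (d′ (to v))))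
    viaQ v = trans (toQ v) (backP v)

    ports-agree : ∀ v i → portAt Q (d′ (to v)) (cast (toQ v) i) ≡ portAt P (d v) i
    ports-agree v i = begin
      portAt Q (d′ (to v)) (cast (toQ v) i)
        ≡⟨ sym (port-map _ _ (backP v)) ⟩
      portAt P (map (d′ (to v))) (cast (backP v) (cast (toQ v) i))
        ≡⟨ cong (portAt P _) (cast-trans (toQ v) (backP v) i) ⟩
      portAt P (map (d′ (to v))) (cast (viaQ v) i)
        ≡⟨ dcong-cast (portAt P) (commutes v) i _ ⟩
      portAt P (d v) i ∎
      where open ≡-Reasoning

    edges-agree : ∀ v i w j → edgeAt Q (d′ (to v)) (cast (toQ v) i) (d′ (to w)) (cast (toQ w) j)
                              ≡ edgeAt P (d v) i (d w) j
    edges-agree v i w j = begin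
      edgeAt Q (d′ (to v)) (cast (toQ v) i) (d′ (to w)) (cast (toQ w) j)
        ≡⟨ sym (edge-map _ _ _ _ (backP v) (backP w)) ⟩
      edgeAt P (map (d′ (to v))) (cast (backP v) (cast (toQ v) i))
               (map (d′ (to w))) (cast (backP w) (cast (toQ w) j))
        ≡⟨ cong₂ (λ a b → edgeAt P _ a _ b)
                 (cast-trans (toQ v) (backP v) i) (cast-trans (toQ w) (backP w) j) ⟩
      edgeAt P (map (d′ (to v))) (cast (viaQ v) i) (map (d′ (to w))) (cast (viaQ w) j)
        ≡⟨ dcong-cast (λ x a → edgeAt P x a (map (d′ (to w))) (cast (viaQ w) j)) (commutes v) i _ ⟩
      edgeAt P (d v) i (map (d′ (to w))) (cast (viaQ w) j)
        ≡⟨ dcong-cast (edgeAt P (d v) i) (commutes w) j _ ⟩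
      edgeAt P (d v) i (d w) j ∎
      where open ≡-Reasoning

module _ {A : Ranked} {n : ℕ} where

  vertexPresentation : HG A n → Presentation {A} {n}
  vertexPresentation G = record
    { Index  = Fin (size G) ; labelAt = label G
    ; portAt = λ v i → port G (v , i) ; edgeAt = λ v i w j → edge G (v , i) (w , j) }

  unionPresentation : HG A n → HG A n → Presentation {A} {n}
  unionPresentation G H = record
    { Index  = Union.S G H ; labelAt = Union.labS G H
    ; portAt = Union.portS G H ; edgeAt = λ x i y j → Union.edgeS G H x y i j }

  relabelPresentation : ∀ {m} → (Fin n → Fin m) → Presentation {A} {n} → Presentation {A} {m}
  relabelPresentation f P = record
    { Index  = Index P ; labelAt = labelAt P
    ; portAt = λ x i → f (portAt P x i) ; edgeAt = edgeAt P }

  addEdgesPresentation : (Fin n → Fin n → Bool) → Presentation {A} {n} → Presentation {A} {n}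
  addEdgesPresentation E P = record
    { Index  = Index P ; labelAt = labelAt P ; portAt = portAt P
    ; edgeAt = λ x i y j → edgeAt P x i y j ∨ E (portAt P x i) (portAt P y j) }

  sameVertices-≅ : ∀ {s ne} {lab : Fin s → Carrier A}
                   {e e′ : Corner A s lab → Corner A s lab → Bool} {p p′ : Corner A s lab → Fin n} →
                   (∀ c c′ → e c c′ ≡ e′ c c′) → (∀ c → p c ≡ p′ c) →
                   _≅_ {A} {n} record { size = s ; nonempty = ne ; label = lab ; edge = e ; port = p }
                               record { size = s ; nonempty = ne ; label = lab ; edge = e′ ; port = p′ }
  sameVertices-≅ {e′ = e′} {p′ = p′} e≡e′ p≡p′ = record
    { vmap       = ↔-refl
    ; label-pres = λ _ → refl
    ; port-pres  = λ (v , i) →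
        trans (cong (λ a → p′ (v , a)) (cast-is-id refl i)) (sym (p≡p′ (v , i)))
    ; edge-pres  = λ (v , i) (w , j) →
        trans (cong₂ (λ a b → e′ (v , a) (w , b)) (cast-is-id refl i) (cast-is-id refl j))
              (sym (e≡e′ _ _))
    }

module FamilyUnion {A : Ranked} {K : ℕ} (s : ℕ) (H : Fin s → HG A K) where

  sizes : Fin s → ℕ
  sizes u = size (H u)

  innerEdge : (u u′ : Fin s) → Corner A (sizes u) (label (H u)) →
              Corner A (sizes u′) (label (H u′)) → Bool
  innerEdge u u′ c c′ with u ≟ u′
  ... | yes refl = edge (H u) c c′
  ... | no _     = false

  index : Fin (sumF s sizes) → Σ[ u ∈ Fin s ] Fin (sizes u)
  index = unpair s sizes

  presentation : Presentation {A} {K}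
  presentation = record
    { Index   = Σ[ u ∈ Fin s ] Fin (sizes u)
    ; labelAt = λ (u , w) → label (H u) w
    ; portAt  = λ (u , w) i → port (H u) (w , i)
    ; edgeAt  = λ (u , w) i (u′ , w′) i′ → innerEdge u u′ (w , i) (w′ , i′) }

⨆ : ∀ {A K} (s : ℕ) → 1 ≤ s → (Fin s → HG A K) → HG A K
⨆ s ne H = realise presentation (sumF s sizes) (sumF-pos s sizes ne (λ u → nonempty (H u))) index
  where open FamilyUnion s H

module _ {A : Ranked} {K : ℕ} where

  ⨆-one-≅ : (ne : 1 ≤ 1) (H : Fin 1 → HG A K) → ⨆ 1 ne H ≅ H zero
  ⨆-one-≅ ne H = realise-≅ reindex index id φ commutes
    where
    open FamilyUnion 1 H

    only : Σ[ u ∈ Fin 1 ] Fin (sizes u) → Fin (sizes zero)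
    only (zero , w) = w

    φ : Fin (sumF 1 sizes) ↔ Fin (sizes zero)
    φ = ↔-trans (↔-sym (Σ↔sumF 1 sizes))
                (mk↔ₛ′ only (zero ,_) (λ _ → refl) (λ { (zero , _) → refl }))

    commutes : ∀ v → (zero , only (index v)) ≡ index v
    commutes v with index v
    ... | zero , _ = refl

    reindex : PresentationMap (vertexPresentation (H zero)) presentation
    reindex = record
      { map       = zero ,_
      ; label-map = λ _ → refl
      ; port-map  = λ w j e → cong (λ a → port (H zero) (w , a)) (cast-is-id e j)
      ; edge-map  = λ w j w′ k e e′ → cong₂ (λ a b → edge (H zero) (w , a) (w′ , b))
                                            (cast-is-id e j) (cast-is-id e′ k)
      }

  ⨆-suc-≅ : ∀ s (ne : 1 ≤ suc (suc s)) (H : Fin (suc (suc s)) → HG A K) →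
            ⨆ (suc (suc s)) ne H ≅ (H zero ⊔ ⨆ (suc s) (s≤s z≤n) (H ∘ suc))
  ⨆-suc-≅ s ne H = realise-≅ reindex Full.index (splitAt (Full.sizes zero)) ↔-refl commutes
    where
    module Full = FamilyUnion (suc (suc s)) H
    module Rest = FamilyUnion (suc s) (H ∘ suc)
    Tail = ⨆ (suc s) (s≤s z≤n) (H ∘ suc)

    split : Union.S (H zero) Tail → Index Full.presentation
    split (inj₁ w) = zero , w
    split (inj₂ k) = suc (proj₁ (Rest.index k)) , proj₂ (Rest.index k)

    commutes : ∀ v → split (splitAt (Full.sizes zero) v) ≡ Full.index v
    commutes v with splitAt (Full.sizes zero) v
    ... | inj₁ _ = refl
    ... | inj₂ _ = refl

    innerEdge-suc : ∀ u u′ c c′ →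
                    Full.innerEdge (suc u) (suc u′) c c′ ≡ Rest.innerEdge u u′ c c′
    innerEdge-suc u u′ c c′ with u ≟ u′
    ... | yes refl = refl
    ... | no _     = refl

    ar = arity A

    edge-map : ∀ y j z k
      .(e : ar (Union.labS (H zero) Tail y) ≡ ar (labelAt Full.presentation (split y)))
      .(e′ : ar (Union.labS (H zero) Tail z) ≡ ar (labelAt Full.presentation (split z))) →
      edgeAt Full.presentation (split y) (cast e j) (split z) (cast e′ k)
        ≡ Union.edgeS (H zero) Tail y z j k
    edge-map (inj₁ w) j (inj₁ w′) k e e′ =
      cong₂ (λ a b → edge (H zero) (w , a) (w′ , b)) (cast-is-id e j) (cast-is-id e′ k)
    edge-map (inj₁ _) _ (inj₂ _) _ _ _ = refl
    edge-map (inj₂ _) _ (inj₁ _) _ _ _ = refl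
    edge-map (inj₂ x) j (inj₂ x′) k e e′ = trans
      (cong₂ (λ a b → edgeAt Full.presentation (split (inj₂ x)) a (split (inj₂ x′)) b)
             (cast-is-id e j) (cast-is-id e′ k))
      (innerEdge-suc (proj₁ (Rest.index x)) (proj₁ (Rest.index x′))
                     (proj₂ (Rest.index x) , j) (proj₂ (Rest.index x′) , k))

    reindex : PresentationMap (unionPresentation (H zero) Tail) Full.presentation
    reindex = record
      { map       = split
      ; label-map = λ { (inj₁ _) → refl ; (inj₂ _) → refl }
      ; port-map  = λ
          { (inj₁ w) j e → cong (portAt Full.presentation (split (inj₁ w))) (cast-is-id e j)
          ; (inj₂ k) j e → cong (portAt Full.presentation (split (inj₂ k))) (cast-is-id e j) }
      ; edge-map  = edge-map
      }

module FlattenDecomposition {A : Ranked} {n : ℕ} (T : HG (V A) n) where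
  open Flatten T using (m; H; dec; innerEdge)

  s : ℕ
  s = size T

  M : ℕ
  M = sumF s m

  blockPort : (u : Fin s) → Fin (m u) → Fin M
  blockPort u j = pair s m (u , j)

  blocks : Fin s → HG A M
  blocks u = relabelPorts (blockPort u) (H u)

  outerPort : Fin M → Fin n
  outerPort a = port T (unpair s m a)

  outerEdge : Fin M → Fin M → Bool
  outerEdge a b = edge T (unpair s m a) (unpair s m b)

  flattenPresentation : Presentation {A} {n}
  flattenPresentation = record
    { Index   = Σ[ u ∈ Fin s ] Fin (size (H u))
    ; labelAt = λ (u , w) → label (H u) w
    ; portAt  = λ (u , w) i → port T (u , port (H u) (w , i))
    ; edgeAt  = λ (u , w) i (u′ , w′) i′ → innerEdge u u′ (w , i) (w′ , i′)
                  ∨ edge T (u , port (H u) (w , i)) (u′ , port (H u′) (w′ , i′)) }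

  flatten-≅ : flatten T ≅ relabelPorts outerPort (addEdges outerEdge (⨆ s (nonempty T) blocks))
  flatten-≅ = realise-≅ reindex dec dec ↔-refl (λ _ → refl)
    where
    module Blocks = FamilyUnion s blocks

    innerEdge-blocks : ∀ u u′ c c′ → innerEdge u u′ c c′ ≡ Blocks.innerEdge u u′ c c′
    innerEdge-blocks u u′ c c′ with u ≟ u′
    ... | yes refl = refl
    ... | no _     = refl

    reindex : PresentationMap
                (relabelPresentation outerPort (addEdgesPresentation outerEdge Blocks.presentation))
                flattenPresentation
    reindex = record
      { map       = id
      ; label-map = λ _ → refl
      ; port-map  = λ (u , w) j e → trans
          (cong (λ a → port T (u , port (H u) (w , a))) (cast-is-id e j))
          (cong (port T) (sym (unpair-pair s m _)))
      ; edge-map  = λ (u , w) j (u′ , w′) k e e′ → trans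
          (cong₂ (λ a b → edgeAt flattenPresentation (u , w) a (u′ , w′) b)
                 (cast-is-id e j) (cast-is-id e′ k))
          (cong₂ _∨_ (innerEdge-blocks u u′ (w , j) (w′ , k))
                     (cong₂ (edge T) (sym (unpair-pair s m _)) (sym (unpair-pair s m _))))
      }

module _ {A : Ranked} where

  VRGen-arity≤ : ∀ {N n G} → VRGen {A} N n G → n ≤ N
  VRGen-arity≤ (unit _ a≤N)        = a≤N
  VRGen-arity≤ (union n≤N _ _)     = n≤N
  VRGen-arity≤ (relabel _ m≤N _ _) = m≤N
  VRGen-arity≤ (edges n≤N _ _)     = n≤N
  VRGen-arity≤ (iso _ g)           = VRGen-arity≤ g

  VRGen-mono : ∀ {N N′ n G} → N ≤ N′ → VRGen {A} N n G → VRGen N′ n G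
  VRGen-mono N≤N′ (unit a a≤N)          = unit a (≤-trans a≤N N≤N′)
  VRGen-mono N≤N′ (union n≤N g h)       =
    union (≤-trans n≤N N≤N′) (VRGen-mono N≤N′ g) (VRGen-mono N≤N′ h)
  VRGen-mono N≤N′ (relabel n≤N m≤N f g) =
    relabel (≤-trans n≤N N≤N′) (≤-trans m≤N N≤N′) f (VRGen-mono N≤N′ g)
  VRGen-mono N≤N′ (edges n≤N E g)       = edges (≤-trans n≤N N≤N′) E (VRGen-mono N≤N′ g)
  VRGen-mono N≤N′ (iso G≅H g)           = iso G≅H (VRGen-mono N≤N′ g)

  ⨆-VRGen : ∀ {N K} s ne (H : Fin s → HG A K) → (∀ u → VRGen N K (H u)) → VRGen N K (⨆ s ne H)
  ⨆-VRGen (suc zero)    ne H gen = iso (⨆-one-≅ ne H) (gen zero)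
  ⨆-VRGen (suc (suc s)) ne H gen = iso (⨆-suc-≅ s ne H)
    (union (VRGen-arity≤ (gen zero)) (gen zero) (⨆-VRGen (suc s) (s≤s z≤n) (H ∘ suc) (gen ∘ suc)))

  flatten-VRGen : ∀ {N n} (T : HG (V A) n) → FlattenDecomposition.M T ≤ N → n ≤ N →
                  (∀ u → VRGen N (Flatten.m T u) (Flatten.H T u)) → VRGen N n (flatten T)
  flatten-VRGen T M≤N n≤N gen =
    iso flatten-≅ (relabel M≤N n≤N outerPort (edges M≤N outerEdge (⨆-VRGen s (nonempty T) blocks
      (λ u → relabel (VRGen-arity≤ (gen u)) M≤N (blockPort u) (gen u)))))
    where open FlattenDecomposition T

module _ {A : Ranked} {n : ℕ} (G : HG A n) where

  unitTerm : HG (V A) n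
  unitTerm = record
    { size     = size G
    ; nonempty = nonempty G
    ; label    = λ v → arity A (label G v) , arity-pos A (label G v) , unitHG (label G v)
    ; edge     = edge G
    ; port     = port G
    }

  ≅-flatten-unitTerm : G ≅ flatten unitTerm
  ≅-flatten-unitTerm =
    realise-≅ reindex id (Flatten.dec unitTerm) φ (λ v → cong proj₁ (unpair-pair s _ (v , zero)))
    where
    open FlattenDecomposition unitTerm using (s; flattenPresentation)
    open Flatten unitTerm using (innerEdge)

    φ : Fin s ↔ Fin (sumF s (λ _ → 1))
    φ = ↔-trans (mk↔ₛ′ (_, zero) proj₁ (λ { (_ , zero) → refl }) (λ _ → refl))
                (Σ↔sumF s (λ _ → 1))

    no-innerEdge : ∀ u u′ c c′ → innerEdge u u′ c c′ ≡ false
    no-innerEdge u u′ c c′ with u ≟ u′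
    ... | yes refl = refl
    ... | no _     = refl

    reindex : PresentationMap flattenPresentation (vertexPresentation G)
    reindex = record
      { map       = proj₁
      ; label-map = λ _ → refl
      ; port-map  = λ (v , _) j e → cong (λ a → port G (v , a)) (cast-is-id e j)
      ; edge-map  = λ (v , w) j (v′ , w′) k e e′ → trans
          (cong₂ (λ a b → edge G (v , a) (v′ , b)) (cast-is-id e j) (cast-is-id e′ k))
          (cong (_∨ edge G (v , j) (v′ , k)) (sym (no-innerEdge v v′ (w , j) (w′ , k))))
      }

  cliquewidthBound : ℕ
  cliquewidthBound = n ⊔ℕ sumF (size G) (λ v → arity A (label G v))

  VRGen-cliquewidthBound : VRGen cliquewidthBound n G
  VRGen-cliquewidthBound = iso ≅-flatten-unitTerm
    (flatten-VRGen unitTerm (m≤n⊔m n _) (m≤m⊔n n _) (λ v → unit (label G v)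
      (≤-trans (≤-sumF (size G) (λ v → arity A (label G v)) v) (m≤n⊔m n _))))

module _ {A : Ranked} where

  labelWidth : {X : Ranked} → Carrier (V A ⊕ X) → ℕ
  labelWidth     (inj₁ (_ , _ , G)) = cliquewidthBound G
  labelWidth {X} (inj₂ x)           = arity X x

  operationWidth : PolyOp A → ℕ
  operationWidth P = arOut P ⊔ℕ sumF (size (term P)) (labelWidth {Vars P} ∘ label (term P))

  width : List (PolyOp A) → ℕ
  width Ps = max 0 (List.map operationWidth Ps)

  operationWidth≤width : ∀ {P Ps} → P ∈ Ps → operationWidth P ≤ width Ps
  operationWidth≤width {Ps = Ps} P∈Ps =
    All.lookup (xs≤max 0 (List.map operationWidth Ps)) (∈-map⁺ operationWidth P∈Ps)

  module _ {X : Ranked} (η : (x : Carrier X) → HG A (arity X x)) where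
    open Subst {A} {X} η using (relab)

    arity≤labelWidth : ∀ ℓ → proj₁ (relab ℓ) ≤ labelWidth {X} ℓ
    arity≤labelWidth (inj₁ (k , _ , _)) = m≤m⊔n k _
    arity≤labelWidth (inj₂ _)           = ≤-refl

    substituted-VRGen : ∀ {N} ℓ → labelWidth {X} ℓ ≤ N → (∀ x → VRGen N (arity X x) (η x)) →
                        VRGen N (proj₁ (relab ℓ)) (proj₂ (proj₂ (relab ℓ)))
    substituted-VRGen (inj₁ (_ , _ , G)) ≤N _   = VRGen-mono ≤N (VRGen-cliquewidthBound G)
    substituted-VRGen (inj₂ x)           _  gen = gen x

  PGen⇒VRGen : ∀ {Ps n G} → PGen Ps n G → VRGen (width Ps) n G
  PGen⇒VRGen (iso G≅H gen) = iso G≅H (PGen⇒VRGen gen)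
  PGen⇒VRGen {Ps} (app P P∈Ps η gen) =
    flatten-VRGen (Subst.substitute {X = Vars P} η t)
      (≤width (≤-trans M≤sum (m≤n⊔m (arOut P) _)))
      (≤width (m≤m⊔n (arOut P) _))
      (λ u → substituted-VRGen {Vars P} η (label t u)
               (≤width (≤-trans (≤-sumF s _ u) (m≤n⊔m (arOut P) _)))
               (λ x → PGen⇒VRGen (gen x)))
    where
    t = term P
    s = size t

    ≤width : ∀ {k} → k ≤ operationWidth P → k ≤ width Ps
    ≤width k≤ = ≤-trans k≤ (operationWidth≤width P∈Ps)

    M≤sum : sumF s (λ u → proj₁ (Subst.relab {X = Vars P} η (label t u)))
            ≤ sumF s (labelWidth {Vars P} ∘ label t)
    M≤sum = sumF-mono-≤ s _ _ (λ u → arity≤labelWidth {Vars P} η (label t u))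

uniformRanked : Set → ℕ → Ranked
uniformRanked C k = record { Carrier = C ; arity = λ _ → suc k ; arity-pos = λ _ → s≤s z≤n }

module _ {A : Ranked} where

  unitOp : Carrier A → PolyOp A
  unitOp a = record
    { Vars = uniformRanked ⊥ 0 ; arOut = arity A a ; arOut-pos = arity-pos A a
    ; term = record { size = 1 ; nonempty = s≤s z≤n
                    ; label = λ _ → inj₁ (arity A a , arity-pos A a , unitHG a)
                    ; edge = λ _ _ → false ; port = proj₂ } }

  unionOp : ℕ → PolyOp A
  unionOp k = record
    { Vars = uniformRanked (Fin 2) k ; arOut = suc k ; arOut-pos = s≤s z≤n
    ; term = record { size = 2 ; nonempty = s≤s z≤n ; label = inj₂
                    ; edge = λ _ _ → false ; port = proj₂ } }

  relabelEdgesOp : (k l : ℕ) → (Fin (suc k) → Fin (suc l)) → (Fin (suc k) → Fin (suc k) → Bool) →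
                   PolyOp A
  relabelEdgesOp k l f E = record
    { Vars = uniformRanked ⊤ k ; arOut = suc l ; arOut-pos = s≤s z≤n
    ; term = record { size = 1 ; nonempty = s≤s z≤n ; label = λ _ → inj₂ tt
                    ; edge = λ c d → E (proj₂ c) (proj₂ d) ; port = λ c → f (proj₂ c) } }

  -- Substituting into the terms of unitOp and relabelEdgesOp gives this term on the nose.
  module _ {m n : ℕ} (X : HG A m) (pos : 1 ≤ m) (E : Fin m → Fin m → Bool) (f : Fin m → Fin n) where

    singleVertexTerm : HG (V A) n
    singleVertexTerm = record
      { size = 1 ; nonempty = s≤s z≤n ; label = λ _ → m , pos , X
      ; edge = λ c d → E (proj₂ c) (proj₂ d) ; port = λ c → f (proj₂ c) }

    relabel-addEdges-≅-flatten : relabelPorts f (addEdges E X) ≅ flatten singleVertexTerm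
    relabel-addEdges-≅-flatten = realise-≅ reindex id (Flatten.dec singleVertexTerm) φ
                                   (λ v → cong proj₂ (unpair-pair 1 _ (zero , v)))
      where
      open FlattenDecomposition singleVertexTerm using (flattenPresentation)

      φ : Fin (size X) ↔ Fin (sumF 1 (λ _ → size X))
      φ = ↔-trans (mk↔ₛ′ (zero ,_) proj₂ (λ { (zero , _) → refl }) (λ _ → refl))
                  (Σ↔sumF 1 (λ _ → size X))

      reindex : PresentationMap flattenPresentation
                  (relabelPresentation f (addEdgesPresentation E (vertexPresentation X)))
      reindex = record
        { map       = proj₂
        ; label-map = λ _ → refl
        ; port-map  = λ (_ , w) j e → cong (λ a → f (port X (w , a))) (cast-is-id e j)
        ; edge-map  = λ { (zero , w) j (zero , w′) k e e′ →
            cong₂ (λ a b → edge X (w , a) (w′ , b) ∨ E (port X (w , a)) (port X (w′ , b)))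
                  (cast-is-id e j) (cast-is-id e′ k) }
        }

  module _ {k : ℕ} (G H : HG A (suc k)) where

    unionValuation : Valuation A (unionOp k)
    unionValuation zero    = G
    unionValuation (suc _) = H

    ⊔-≅-applyUnionOp : (G ⊔ H) ≅ applyOp (unionOp k) unionValuation
    ⊔-≅-applyUnionOp = realise-≅ reindex (splitAt (size G)) (Flatten.dec T) φ commutes
      where
      T = Subst.substitute unionValuation (term (unionOp k))
      open FlattenDecomposition T using (flattenPresentation)

      sizes : Fin 2 → ℕ
      sizes u = size (unionValuation u)

      toΣ : Fin (size G) ⊎ Fin (size H) → Σ[ u ∈ Fin 2 ] Fin (sizes u)
      toΣ (inj₁ w) = zero , w
      toΣ (inj₂ w) = suc zero , w

      fromΣ : Σ[ u ∈ Fin 2 ] Fin (sizes u) → Fin (size G) ⊎ Fin (size H)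
      fromΣ (zero , w)     = inj₁ w
      fromΣ (suc zero , w) = inj₂ w

      fromΣ-toΣ : ∀ y → fromΣ (toΣ y) ≡ y
      fromΣ-toΣ (inj₁ _) = refl
      fromΣ-toΣ (inj₂ _) = refl

      toΣ-fromΣ : ∀ x → toΣ (fromΣ x) ≡ x
      toΣ-fromΣ (zero , _)     = refl
      toΣ-fromΣ (suc zero , _) = refl

      φ : Fin (size G + size H) ↔ Fin (sumF 2 sizes)
      φ = ↔-trans +↔⊎ (↔-trans (mk↔ₛ′ toΣ fromΣ toΣ-fromΣ fromΣ-toΣ) (Σ↔sumF 2 sizes))

      commutes : ∀ v → fromΣ (unpair 2 sizes (Inverse.to φ v)) ≡ splitAt (size G) v
      commutes v = trans (cong fromΣ (unpair-pair 2 sizes _)) (fromΣ-toΣ _)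

      edge-map : ∀ y j z l
        .(e : arity A (labelAt flattenPresentation y) ≡ arity A (Union.labS G H (fromΣ y)))
        .(e′ : arity A (labelAt flattenPresentation z) ≡ arity A (Union.labS G H (fromΣ z))) →
        Union.edgeS G H (fromΣ y) (fromΣ z) (cast e j) (cast e′ l) ≡ edgeAt flattenPresentation y j z l
      edge-map (zero , w) j (zero , w′) l e e′ = trans
        (cong₂ (λ a b → edge G (w , a) (w′ , b)) (cast-is-id e j) (cast-is-id e′ l))
        (sym (∨-identityʳ _))
      edge-map (suc zero , w) j (suc zero , w′) l e e′ = trans
        (cong₂ (λ a b → edge H (w , a) (w′ , b)) (cast-is-id e j) (cast-is-id e′ l))
        (sym (∨-identityʳ _))
      edge-map (zero , _) _ (suc zero , _) _ _ _ = refl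
      edge-map (suc zero , _) _ (zero , _) _ _ _ = refl

      reindex : PresentationMap flattenPresentation (unionPresentation G H)
      reindex = record
        { map       = fromΣ
        ; label-map = λ { (zero , _) → refl ; (suc zero , _) → refl }
        ; port-map  = λ { (zero , w) j e → cong (λ a → port G (w , a)) (cast-is-id e j)
                        ; (suc zero , w) j e → cong (λ a → port H (w , a)) (cast-is-id e j) }
        ; edge-map  = edge-map
        }

  no-nullary : HG A 0 → ⊥
  no-nullary G = ¬Fin0 (port G (v , fromℕ< (arity-pos A (label G v))))
    where v = fromℕ< (nonempty G)

module _ {B : Set} where

  functionsInto : List B → (k : ℕ) → List (Fin k → B)
  functionsInto bs zero    = Vec.[] ∷ []
  functionsInto bs (suc k) = List.cartesianProductWith Vec._∷_ bs (functionsInto bs k)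

  functionsInto-complete : ∀ {bs} (R : B → B → Set) → (∀ b → ∃[ b′ ] b′ ∈ bs × R b′ b) →
                           ∀ {k} (f : Fin k → B) →
                           ∃[ g ] g ∈ functionsInto bs k × (∀ i → R (g i) (f i))
  functionsInto-complete R approx {zero} f = Vec.[] , here refl , λ ()
  functionsInto-complete R approx {suc k} f
    with approx (f zero) | functionsInto-complete R approx (f ∘ suc)
  ... | b , b∈ , Rb | g , g∈ , Rg =
    b Vec.∷ g , ∈-cartesianProductWith⁺ Vec._∷_ b∈ g∈ , λ { zero → Rb ; (suc i) → Rg i }

portMaps : (k l : ℕ) → List (Fin k → Fin l)
portMaps k l = functionsInto (List.allFin l) k

portMaps-complete : ∀ {k l} (f : Fin k → Fin l) → ∃[ g ] g ∈ portMaps k l × (∀ i → g i ≡ f i)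
portMaps-complete = functionsInto-complete _≡_ (λ b → b , ∈-allFin b , refl)

relations : (k : ℕ) → List (Fin k → Fin k → Bool)
relations k = functionsInto (functionsInto (true ∷ false ∷ []) k) k

relations-complete : ∀ {k} (E : Fin k → Fin k → Bool) →
                     ∃[ E′ ] E′ ∈ relations k × (∀ i j → E′ i j ≡ E i j)
relations-complete = functionsInto-complete (λ g h → ∀ j → g j ≡ h j)
  (functionsInto-complete _≡_
    λ { true → true , here refl , refl ; false → false , there (here refl) , refl })

∈-concatMap⁺′ : ∀ {a b} {X : Set a} {Y : Set b} {f : X → List Y} {x xs y} →
                x ∈ xs → y ∈ f x → y ∈ List.concatMap f xs
∈-concatMap⁺′ {f = f} x∈xs y∈fx = ∈-concat⁺′ y∈fx (∈-map⁺ f x∈xs)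

elements : ∀ {C : Set} {k} → C ↔ Fin k → List C
elements {k = k} ι = List.map (Inverse.from ι) (List.allFin k)

∈-elements : ∀ {C : Set} {k} (ι : C ↔ Fin k) c → c ∈ elements ι
∈-elements ι c = subst (_∈ elements ι) (Inverse.strictlyInverseʳ ι c)
                   (∈-map⁺ (Inverse.from ι) (∈-allFin (Inverse.to ι c)))

module _ {A : Ranked} where

  unitOps : Finite A → List (PolyOp A)
  unitOps (_ , ι) = List.map unitOp (elements ι)

  unionOps : ℕ → List (PolyOp A)
  unionOps N = List.map unionOp (List.upTo N)

  relabelEdgesOps : ℕ → List (PolyOp A)
  relabelEdgesOps N =
    List.concatMap (λ k → List.concatMap (λ l → List.concatMap (λ f →
      List.map (relabelEdgesOp k l f) (relations (suc k)))
        (portMaps (suc k) (suc l))) (List.upTo N)) (List.upTo N)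

  vrOperations : ℕ → Finite A → List (PolyOp A)
  vrOperations N fin = unitOps fin ++ unionOps N ++ relabelEdgesOps N

  module _ {N : ℕ} (fin : Finite A) where

    unitOp∈ : ∀ a → unitOp a ∈ vrOperations N fin
    unitOp∈ a = ∈-++⁺ˡ (∈-map⁺ unitOp (∈-elements (proj₂ fin) a))

    unionOp∈ : ∀ {k} → suc k ≤ N → unionOp k ∈ vrOperations N fin
    unionOp∈ k<N = ∈-++⁺ʳ (unitOps fin) (∈-++⁺ˡ (∈-map⁺ unionOp (∈-upTo⁺ k<N)))

    relabelEdgesOp∈ : ∀ {k l f E} → suc k ≤ N → suc l ≤ N →
                      f ∈ portMaps (suc k) (suc l) → E ∈ relations (suc k) →
                      relabelEdgesOp k l f E ∈ vrOperations N fin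
    relabelEdgesOp∈ k<N l<N f∈ E∈ = ∈-++⁺ʳ (unitOps fin) (∈-++⁺ʳ (unionOps N)
      (∈-concatMap⁺′ (∈-upTo⁺ k<N)
        (∈-concatMap⁺′ (∈-upTo⁺ l<N) (∈-concatMap⁺′ f∈ (∈-map⁺ _ E∈)))))

    relabelEdges-PGen : ∀ {k l f E G} → suc k ≤ N → suc l ≤ N →
                        f ∈ portMaps (suc k) (suc l) → E ∈ relations (suc k) →
                        PGen (vrOperations N fin) (suc k) G →
                        PGen (vrOperations N fin) (suc l) (relabelPorts f (addEdges E G))
    relabelEdges-PGen {k} {l} {f} {E} {G} k<N l<N f∈ E∈ gen =
      iso (relabel-addEdges-≅-flatten G (s≤s z≤n) E f)
          (app (relabelEdgesOp k l f E) (relabelEdgesOp∈ k<N l<N f∈ E∈) (λ _ → G) (λ _ → gen))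

    VRGen⇒PGen : ∀ {n G} → VRGen N n G → PGen (vrOperations N fin) n G
    VRGen⇒PGen (unit a _) =
      iso (relabel-addEdges-≅-flatten (unitHG a) (arity-pos A a) (λ _ _ → false) id)
          (app (unitOp a) (unitOp∈ a) (λ ()) (λ ()))
    VRGen⇒PGen (union {zero} {G} _ _ _) = ⊥-elim (no-nullary G)
    VRGen⇒PGen (union {suc k} {G} {H} k<N g h) =
      iso (⊔-≅-applyUnionOp G H) (app (unionOp k) (unionOp∈ k<N) (unionValuation G H)
        λ { zero → VRGen⇒PGen g ; (suc _) → VRGen⇒PGen h })
    VRGen⇒PGen (relabel {zero} {G = G} _ _ _ _)     = ⊥-elim (no-nullary G)
    VRGen⇒PGen (relabel {suc _} {zero} {G} _ _ f _) = ⊥-elim (no-nullary (relabelPorts f G))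
    VRGen⇒PGen (relabel {suc k} {suc l} k<N l<N f g)
      with portMaps-complete f | relations-complete (λ (_ _ : Fin (suc k)) → false)
    ... | f′ , f′∈ , f′≗f | E′ , E′∈ , E′≗∅ =
      iso (sameVertices-≅ (λ _ _ → sym (trans (cong (_ ∨_) (E′≗∅ _ _)) (∨-identityʳ _)))
                          (λ _ → sym (f′≗f _)))
          (relabelEdges-PGen k<N l<N f′∈ E′∈ (VRGen⇒PGen g))
    VRGen⇒PGen (edges {zero} {G} _ _ _) = ⊥-elim (no-nullary G)
    VRGen⇒PGen (edges {suc k} k<N E g)
      with portMaps-complete id | relations-complete E
    ... | id′ , id′∈ , id′≗id | E′ , E′∈ , E′≗E =
      iso (sameVertices-≅ (λ _ _ → cong (_ ∨_) (sym (E′≗E _ _))) (λ _ → sym (id′≗id _)))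
          (relabelEdges-PGen k<N k<N id′∈ E′∈ (VRGen⇒PGen g))
    VRGen⇒PGen (iso G≅H g) = iso G≅H (VRGen⇒PGen g)

module _ (A : Ranked) (L : VElem A → Set) where

  boundedCliquewidth⇒polyGenerated : Finite A → BoundedCliquewidth A L → PolyGenerated A L
  boundedCliquewidth⇒polyGenerated fin (N , cw≤N) = vrOperations N fin , λ e e∈L →
    let (_ , _ , k≤N , gen) = cw≤N e e∈L in VRGen⇒PGen fin (VRGen-mono k≤N gen)

  polyGenerated⇒boundedCliquewidth : PolyGenerated A L → BoundedCliquewidth A L
  polyGenerated⇒boundedCliquewidth (Ps , gen) = suc (width Ps) , λ e e∈L →
    suc (width Ps) , s≤s z≤n , ≤-refl , VRGen-mono (n≤1+n _) (PGen⇒VRGen (gen e e∈L))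

theorem5p9 : (Σ' : Ranked) → Finite Σ' → (L : VElem Σ' → Set) →
    BoundedCliquewidth Σ' L ⇔ PolyGenerated Σ' L
theorem5p9 Σ' fin L =
  mk⇔ (boundedCliquewidth⇒polyGenerated Σ' L fin) (polyGenerated⇒boundedCliquewidth Σ' L)
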